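{- For integers $n$ and $m\ge0$, let $C^{Q}(n,m)$ be the number of vertically constrained $S_{CW}$ paths from $(0,0)$ to $(n,m)$ all of whose vertices have $y\ge0$ (first step arbitrary). Then $C^{Q}(p,m)=0$ if $p<0$; $C^{Q}(0,m)=1$ if $m\in\{0,2\}$ and $0$ otherwise; and for $n\ge1$: $$C^{Q}(n,0)=C^{Q}(n-1,3)+C^{Q}(n-2,2)+2C^{Q}(n-1,1)+C^{Q}(n-2,0),$$ $$C^{Q}(n,1)=C^{Q}(n-1,4)+C^{Q}(n-2,3)+2C^{Q}(n-1,2)+C^{Q}(n-2,1)+C^{Q}(n-1,0),$$ $$C^{Q}(n,2)=C^{Q}(n-1,5)+C^{Q}(n-2,4)+2C^{Q}(n-1,3)+C^{Q}(n-2,2)+2C^{Q}(n-1,1)+C^{Q}(n-2,0),$$ and for $m\ge3$, $$C^{Q}(n,m)=C^{Q}(n-1,m+3)+C^{Q}(n-2,m+2)+2C^{Q}(n-1,m+1)+C^{Q}(n-2,m)+2C^{Q}(n-1,m-1)+C^{Q}(n-2,m-2)+C^{Q}(n-1,m-3).$$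
   Context: A lattice path is a finite sequence of steps (vectors in $\mathbb{Z}^2$) starting at $(0,0)$; its vertices are the partial sums, and it terminates at the last vertex (the empty path terminates at $(0,0)$). Let $S_C=\{(1,1),(1,-1),(2,0)\}$ and $S_{CW}=S_C\cup\{(0,2),(0,-2)\}$; $(0,\pm2)$ are vertical steps. A vertically constrained $S_{CW}$ path is a lattice path with steps in $S_{CW}$ in which no two consecutive steps are both vertical. -}

module Defs where

open import Data.Integer using (ℤ; +_; _+_; _≤_)
open import Data.List using (List; []; _∷_)
open import Data.List.Relation.Unary.All using (All)
open import Data.Product using (Σ; _×_; _,_; proj₂)
open import Data.Unit using (⊤)
open import Data.Empty using (⊥)
open import Relation.Binary.PropositionalEquality using (_≡_)

data Step : Set where
  up    : Step
  down  : Step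
  flat  : Step
  vup   : Step
  vdown : Step

vec : Step → ℤ × ℤ
vec up    = (+ 1 , + 1)
vec down  = (+ 1 , Data.Integer.-[1+ 0 ])
vec flat  = (+ 2 , + 0)
vec vup   = (+ 0 , + 2)
vec vdown = (+ 0 , Data.Integer.-[1+ 1 ])

Vertical : Step → Set
Vertical vup   = ⊤
Vertical vdown = ⊤
Vertical _     = ⊥

_⊕_ : ℤ × ℤ → ℤ × ℤ → ℤ × ℤ
(a , b) ⊕ (c , d) = (a + c , b + d)

verticesFrom : ℤ × ℤ → List Step → List (ℤ × ℤ)
verticesFrom v []      = v ∷ []
verticesFrom v (s ∷ p) = v ∷ verticesFrom (v ⊕ vec s) p

vertices : List Step → List (ℤ × ℤ)
vertices = verticesFrom (+ 0 , + 0)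

endFrom : ℤ × ℤ → List Step → ℤ × ℤ
endFrom v []      = v
endFrom v (s ∷ p) = endFrom (v ⊕ vec s) p

endpoint : List Step → ℤ × ℤ
endpoint = endFrom (+ 0 , + 0)

VertConstrained : List Step → Set
VertConstrained []            = ⊤
VertConstrained (s ∷ [])      = ⊤
VertConstrained (s ∷ t ∷ p)   = ((Vertical s × Vertical t) → ⊥) × VertConstrained (t ∷ p)

QPath : ℤ → ℤ → Set
QPath n m = Σ (List Step) λ p →
  VertConstrained p × All (λ v → + 0 ≤ proj₂ v) (vertices p) × endpoint p ≡ (n , m)

-- Read a walk backwards. Its last step is either non-vertical, or vertical and then
-- preceded by a non-vertical step or by nothing at all. Writing H(n,m) for the walks
-- ending at (n,m) that are empty or end with a non-vertical step, and letting C and H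
-- vanish at negative coordinates, this gives
--   C(n,m) = H(n,m) + H(n,m-2) + H(n,m+2),
--   H(n,m) = [n = m = 0] + C(n-1,m-1) + C(n-1,m+1) + C(n-2,m),
-- and substituting H into C yields the four recurrences.
module Submission where

open import Defs
open import Data.Nat using (ℕ; _∸_) renaming (_+_ to _+ℕ_; _*_ to _*ℕ_; _≤_ to _≤ℕ_)
open import Data.Integer using (ℤ; +_; _-_; _<_; _≤_)
open import Data.Fin using (Fin)
open import Data.Product using (Σ; _×_)
open import Data.Sum using (_⊎_)
open import Function.Bundles using (_↔_)
open import Relation.Binary.PropositionalEquality using (_≡_; _≢_)

open import Algebra.Bundles using (AbelianGroup)
open import Axiom.UniquenessOfIdentityProofs.WithK using (uip)
open import Data.Empty using (⊥-elim)
import Data.Fin as Fin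
open import Data.Fin.Properties using (+↔⊎)
open import Data.Integer using (-[1+_]; +≤+; +<+; _+_)
import Data.Integer.Properties as ℤ
open import Data.List using (List; []; _∷_; _∷ʳ_; reverse)
open import Data.List.Properties using (unfold-reverse; reverse-involutive)
open import Data.List.Relation.Unary.All as All using (All; []; _∷_)
open import Data.List.Relation.Unary.All.Properties using (∷ʳ⁺)
open import Data.Nat using (zero; suc; s≤s; z≤n)
import Data.Nat.Properties as ℕ
open import Data.Nat.Tactic.RingSolver using (solve-∀)
open import Data.Product using (_,_; proj₁; proj₂; swap)
open import Data.Product.Function.Dependent.Propositional using (Σ-↔)
open import Data.Product.Function.NonDependent.Propositional using (_×-⇔_)
open import Data.Sum using (inj₁; inj₂)
open import Data.Sum.Algebra using (⊎-cong)
open import Data.Unit using (⊤; tt)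
open import Function.Base using (_∘_; id)
open import Function.Bundles using (_⇔_; mk⇔; mk↔ₛ′; module Equivalence)
open import Function.Construct.Composition using (_⇔-∘_)
open import Function.Construct.Identity using (⇔-id)
open import Function.Properties.Inverse using (↔-refl; ↔-trans; ↔-sym)
open import Relation.Binary.PropositionalEquality
  using (refl; sym; trans; cong; cong₂; subst; module ≡-Reasoning)
open import Relation.Nullary using (¬_; Irrelevant)

open import Algebra.Properties.Group (AbelianGroup.group ℤ.+-0-abelianGroup)
  using (//-rightDividesˡ; //-rightDividesʳ)

⇔⇒↔ : {A B : Set} → Irrelevant A → Irrelevant B → A ⇔ B → A ↔ B
⇔⇒↔ A-irr B-irr A⇔B = mk↔ₛ′ to from (λ b → B-irr _ b) (λ a → A-irr _ a)
  where open Equivalence A⇔B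

Σ-⇔ : {A : Set} {P Q : A → Set} → (∀ x → Irrelevant (P x)) → (∀ x → Irrelevant (Q x)) →
      (∀ x → P x ⇔ Q x) → Σ A P ↔ Σ A Q
Σ-⇔ P-irr Q-irr P⇔Q = Σ-↔ ↔-refl (λ {x} → ⇔⇒↔ (P-irr x) (Q-irr x) (P⇔Q x))

Fin-+↔ : ∀ {m n} {A B : Set} → Fin m ↔ A → Fin n ↔ B → Fin (m +ℕ n) ↔ (A ⊎ B)
Fin-+↔ i j = ↔-trans +↔⊎ (⊎-cong i j)

¬⇒Fin0↔ : {A : Set} → ¬ A → Fin 0 ↔ A
¬⇒Fin0↔ ¬a = mk↔ₛ′ (λ ()) (⊥-elim ∘ ¬a) (⊥-elim ∘ ¬a) (λ ())

Fin1↔ : {A : Set} → Irrelevant A → A → Fin 1 ↔ A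
Fin1↔ A-irr a = mk↔ₛ′ (λ _ → a) (λ _ → Fin.zero) (A-irr a) λ { Fin.zero → refl ; (Fin.suc ()) }

All-reverse : ∀ {A : Set} {P : A → Set} {xs} → All P xs → All P (reverse xs)
All-reverse {xs = []}     []         = []
All-reverse {xs = x ∷ xs} (px ∷ pxs) =
  subst (All _) (sym (unfold-reverse x xs)) (∷ʳ⁺ (All-reverse pxs) px)

reverse-⇔ : ∀ {A : Set} {Q : List A → Set} → (∀ {xs} → Q xs → Q (reverse xs)) →
            ∀ xs → Q xs ⇔ Q (reverse xs)
reverse-⇔ {Q = Q} Q-reverse xs = mk⇔ Q-reverse (subst Q (reverse-involutive xs) ∘ Q-reverse)

i-j+j≡i : ∀ i j → i - j + j ≡ i
i-j+j≡i i j = //-rightDividesˡ j i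

i+j-j≡i : ∀ i j → i + j - j ≡ i
i+j-j≡i i j = //-rightDividesʳ j i

⊕-cancelʳ : ∀ {u u′} v → u ⊕ v ≡ u′ ⊕ v → u ≡ u′
⊕-cancelʳ {a , b} {a′ , b′} (c , d) eq =
  cong₂ _,_ (+-cancelʳ a a′ c (cong proj₁ eq)) (+-cancelʳ b b′ d (cong proj₂ eq))
  where
  +-cancelʳ : ∀ i i′ j → i + j ≡ i′ + j → i ≡ i′
  +-cancelʳ i i′ j e = trans (sym (i+j-j≡i i j)) (trans (cong (_- j) e) (i+j-j≡i i′ j))

endFrom-∷ʳ : ∀ v p s → endFrom v (p ∷ʳ s) ≡ endFrom v p ⊕ vec s
endFrom-∷ʳ v []      s = refl
endFrom-∷ʳ v (t ∷ p) s = endFrom-∷ʳ (v ⊕ vec t) p s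

verticesFrom-∷ʳ : ∀ v p s →
  verticesFrom v (p ∷ʳ s) ≡ verticesFrom v p ∷ʳ (endFrom v p ⊕ vec s)
verticesFrom-∷ʳ v []      s = refl
verticesFrom-∷ʳ v (t ∷ p) s = cong (v ∷_) (verticesFrom-∷ʳ (v ⊕ vec t) p s)

VertConstrained-∷ʳ : ∀ p {t s} → VertConstrained (p ∷ʳ t) → ¬ (Vertical t × Vertical s) →
                     VertConstrained (p ∷ʳ t ∷ʳ s)
VertConstrained-∷ʳ []          _        ts = ts , tt
VertConstrained-∷ʳ (r ∷ [])    (rt , _) ts = rt , ts , tt
VertConstrained-∷ʳ (r ∷ q ∷ p) (rq , c) ts = rq , VertConstrained-∷ʳ (q ∷ p) c ts

VertConstrained-reverse : ∀ p → VertConstrained p → VertConstrained (reverse p)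
VertConstrained-reverse []          _        = tt
VertConstrained-reverse (s ∷ [])    _        = tt
VertConstrained-reverse (s ∷ t ∷ p) (st , c) =
  subst VertConstrained (sym reverse-st)
    (VertConstrained-∷ʳ (reverse p)
      (subst VertConstrained (unfold-reverse t p) (VertConstrained-reverse (t ∷ p) c))
      (st ∘ swap))
  where
  reverse-st : reverse (s ∷ t ∷ p) ≡ reverse p ∷ʳ t ∷ʳ s
  reverse-st = trans (unfold-reverse s (t ∷ p)) (cong (_∷ʳ s) (unfold-reverse t p))

origin : ℤ × ℤ
origin = (+ 0 , + 0)

-- A walk is encoded by its list of steps from the last one back to the first, so that
-- its last step is the head of the list; endpointʳ and verticesʳ read it that way.
endpointʳ : List Step → ℤ × ℤ
endpointʳ []       = origin
endpointʳ (s ∷ rs) = endpointʳ rs ⊕ vec s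

verticesʳ : List Step → List (ℤ × ℤ)
verticesʳ []       = origin ∷ []
verticesʳ (s ∷ rs) = endpointʳ (s ∷ rs) ∷ verticesʳ rs

endpoint-reverse : ∀ rs → endpoint (reverse rs) ≡ endpointʳ rs
endpoint-reverse []       = refl
endpoint-reverse (s ∷ rs) = begin
  endpoint (reverse (s ∷ rs))    ≡⟨ cong endpoint (unfold-reverse s rs) ⟩
  endpoint (reverse rs ∷ʳ s)     ≡⟨ endFrom-∷ʳ origin (reverse rs) s ⟩
  endpoint (reverse rs) ⊕ vec s  ≡⟨ cong (_⊕ vec s) (endpoint-reverse rs) ⟩
  endpointʳ (s ∷ rs)             ∎
  where open ≡-Reasoning

vertices-reverse : ∀ rs → vertices (reverse rs) ≡ reverse (verticesʳ rs)
vertices-reverse []       = refl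
vertices-reverse (s ∷ rs) = begin
  vertices (reverse (s ∷ rs))
    ≡⟨ cong vertices (unfold-reverse s rs) ⟩
  vertices (reverse rs ∷ʳ s)
    ≡⟨ verticesFrom-∷ʳ origin (reverse rs) s ⟩
  vertices (reverse rs) ∷ʳ (endpoint (reverse rs) ⊕ vec s)
    ≡⟨ cong₂ (λ vs v → vs ∷ʳ (v ⊕ vec s)) (vertices-reverse rs) (endpoint-reverse rs) ⟩
  reverse (verticesʳ rs) ∷ʳ endpointʳ (s ∷ rs)
    ≡⟨ sym (unfold-reverse (endpointʳ (s ∷ rs)) (verticesʳ rs)) ⟩
  reverse (verticesʳ (s ∷ rs))
    ∎
  where open ≡-Reasoning

NonNeg : ℤ × ℤ → Set
NonNeg v = + 0 ≤ proj₂ v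

IsWalk : ℤ × ℤ → List Step → Set
IsWalk w rs = VertConstrained rs × All NonNeg (verticesʳ rs) × endpointʳ rs ≡ w

Walk : ℤ × ℤ → Set
Walk w = Σ (List Step) (IsWalk w)

-- Proofs of a negation are definitionally equal, ⊥ being a record with an irrelevant field.
VertConstrained-irrelevant : ∀ p → Irrelevant (VertConstrained p)
VertConstrained-irrelevant []          _        _       = refl
VertConstrained-irrelevant (s ∷ [])    _        _       = refl
VertConstrained-irrelevant (s ∷ t ∷ p) (st , c) (_ , d) =
  cong (st ,_) (VertConstrained-irrelevant (t ∷ p) c d)

walk-data-irrelevant : ∀ p vs {v w : ℤ × ℤ} →
  Irrelevant (VertConstrained p × All NonNeg vs × v ≡ w)
walk-data-irrelevant p vs (c , a , e) (c′ , a′ , e′) =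
  cong₂ _,_ (VertConstrained-irrelevant p c c′)
            (cong₂ _,_ (All.irrelevant ℤ.≤-irrelevant a a′) (uip e e′))

IsWalk-irrelevant : ∀ {w} rs → Irrelevant (IsWalk w rs)
IsWalk-irrelevant rs = walk-data-irrelevant rs (verticesʳ rs)

Walk↔QPath : ∀ n m → Walk (n , m) ↔ QPath n m
Walk↔QPath n m = Σ-↔ reverse↔ λ {rs} →
  ⇔⇒↔ (IsWalk-irrelevant rs) (walk-data-irrelevant (reverse rs) (vertices (reverse rs)))
      (reverse-walk rs)
  where
  reverse↔ : List Step ↔ List Step
  reverse↔ = mk↔ₛ′ reverse reverse reverse-involutive reverse-involutive
  reverse-walk : ∀ rs → IsWalk (n , m) rs ⇔
    (VertConstrained (reverse rs) × All NonNeg (vertices (reverse rs)) ×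
     endpoint (reverse rs) ≡ (n , m))
  reverse-walk rs =
    reverse-⇔ {Q = VertConstrained} (VertConstrained-reverse _) rs
    ×-⇔ subst (λ vs → All NonNeg (verticesʳ rs) ⇔ All NonNeg vs) (sym (vertices-reverse rs))
          (reverse-⇔ {Q = All NonNeg} All-reverse (verticesʳ rs))
    ×-⇔ mk⇔ (trans (endpoint-reverse rs)) (trans (sym (endpoint-reverse rs)))

EndsWith : Step → ℤ × ℤ → Set
EndsWith s w = Σ (List Step) λ rs → IsWalk w (s ∷ rs)

EndsHorizontally : List Step → Set
EndsHorizontally []      = ⊤
EndsHorizontally (s ∷ _) = ¬ Vertical s

EndsHorizontally-irrelevant : ∀ rs → Irrelevant (EndsHorizontally rs)
EndsHorizontally-irrelevant []      _ _ = refl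
EndsHorizontally-irrelevant (_ ∷ _) _ _ = refl

HWalk : ℤ × ℤ → Set
HWalk w = Σ (List Step) λ rs → EndsHorizontally rs × IsWalk w rs

Walk↔lastStep : ∀ w → Walk w ↔ (HWalk w ⊎ (EndsWith vup w ⊎ EndsWith vdown w))
Walk↔lastStep w = mk↔ₛ′ split join split∘join join∘split
  where
  split : Walk w → HWalk w ⊎ (EndsWith vup w ⊎ EndsWith vdown w)
  split ([]         , c) = inj₁ ([] , tt , c)
  split (up ∷ rs    , c) = inj₁ (up ∷ rs , (λ ()) , c)
  split (down ∷ rs  , c) = inj₁ (down ∷ rs , (λ ()) , c)
  split (flat ∷ rs  , c) = inj₁ (flat ∷ rs , (λ ()) , c)
  split (vup ∷ rs   , c) = inj₂ (inj₁ (rs , c))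
  split (vdown ∷ rs , c) = inj₂ (inj₂ (rs , c))
  join : HWalk w ⊎ (EndsWith vup w ⊎ EndsWith vdown w) → Walk w
  join (inj₁ (rs , _ , c))    = rs , c
  join (inj₂ (inj₁ (rs , c))) = vup ∷ rs , c
  join (inj₂ (inj₂ (rs , c))) = vdown ∷ rs , c
  split∘join : ∀ x → split (join x) ≡ x
  split∘join (inj₁ ([]         , _))     = refl
  split∘join (inj₁ (up ∷ _     , _))     = refl
  split∘join (inj₁ (down ∷ _   , _))     = refl
  split∘join (inj₁ (flat ∷ _   , _))     = refl
  split∘join (inj₁ (vup ∷ _    , h , _)) = ⊥-elim (h tt)
  split∘join (inj₁ (vdown ∷ _  , h , _)) = ⊥-elim (h tt)
  split∘join (inj₂ (inj₁ _))             = refl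
  split∘join (inj₂ (inj₂ _))             = refl
  join∘split : ∀ x → join (split x) ≡ x
  join∘split ([]        , _) = refl
  join∘split (up ∷ _    , _) = refl
  join∘split (down ∷ _  , _) = refl
  join∘split (flat ∷ _  , _) = refl
  join∘split (vup ∷ _   , _) = refl
  join∘split (vdown ∷ _ , _) = refl

HWalk↔lastStep : ∀ w →
  HWalk w ↔ (IsWalk w [] ⊎ (EndsWith up w ⊎ (EndsWith down w ⊎ EndsWith flat w)))
HWalk↔lastStep w = mk↔ₛ′ split join split∘join join∘split
  where
  split : HWalk w → IsWalk w [] ⊎ (EndsWith up w ⊎ (EndsWith down w ⊎ EndsWith flat w))
  split ([]         , _ , c) = inj₁ c
  split (up ∷ rs    , _ , c) = inj₂ (inj₁ (rs , c))
  split (down ∷ rs  , _ , c) = inj₂ (inj₂ (inj₁ (rs , c)))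
  split (flat ∷ rs  , _ , c) = inj₂ (inj₂ (inj₂ (rs , c)))
  split (vup ∷ _    , h , _) = ⊥-elim (h tt)
  split (vdown ∷ _  , h , _) = ⊥-elim (h tt)
  join : IsWalk w [] ⊎ (EndsWith up w ⊎ (EndsWith down w ⊎ EndsWith flat w)) → HWalk w
  join (inj₁ c)                      = [] , tt , c
  join (inj₂ (inj₁ (rs , c)))        = up ∷ rs , (λ ()) , c
  join (inj₂ (inj₂ (inj₁ (rs , c)))) = down ∷ rs , (λ ()) , c
  join (inj₂ (inj₂ (inj₂ (rs , c)))) = flat ∷ rs , (λ ()) , c
  split∘join : ∀ x → split (join x) ≡ x
  split∘join (inj₁ _)               = refl
  split∘join (inj₂ (inj₁ _))        = refl
  split∘join (inj₂ (inj₂ (inj₁ _))) = refl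
  split∘join (inj₂ (inj₂ (inj₂ _))) = refl
  join∘split : ∀ x → join (split x) ≡ x
  join∘split ([]        , _)     = refl
  join∘split (up ∷ _    , _)     = refl
  join∘split (down ∷ _  , _)     = refl
  join∘split (flat ∷ _  , _)     = refl
  join∘split (vup ∷ _   , h , _) = ⊥-elim (h tt)
  join∘split (vdown ∷ _ , h , _) = ⊥-elim (h tt)

Adjacent : Step → List Step → Set
Adjacent s []      = ⊤
Adjacent s (t ∷ _) = ¬ (Vertical s × Vertical t)

VertConstrained-∷ : ∀ s rs → VertConstrained (s ∷ rs) ⇔ (Adjacent s rs × VertConstrained rs)
VertConstrained-∷ s []      = mk⇔ (λ _ → tt , tt) (λ _ → tt)
VertConstrained-∷ s (t ∷ _) = mk⇔ id id

-- The point u before the last step is passed with u ⊕ vec s ≡ w rather than computed as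
-- w minus vec s, which would leave terms such as + x - + 0 that do not reduce to + x.
IsWalk-∷ : ∀ {s u w} rs → NonNeg w → u ⊕ vec s ≡ w →
           IsWalk w (s ∷ rs) ⇔ (Adjacent s rs × IsWalk u rs)
IsWalk-∷ {s} {u} {w} rs w≥0 u+s≡w = mk⇔ to from
  where
  open Equivalence (VertConstrained-∷ s rs) renaming (to to uncons; from to cons)
  to : IsWalk w (s ∷ rs) → Adjacent s rs × IsWalk u rs
  to (c , _ ∷ a , e) =
    proj₁ (uncons c) , proj₂ (uncons c) , a , ⊕-cancelʳ (vec s) (trans e (sym u+s≡w))
  from : Adjacent s rs × IsWalk u rs → IsWalk w (s ∷ rs)
  from (adj , c , a , e) = cons (adj , c) , subst NonNeg (sym e′) w≥0 ∷ a , e′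
    where
    e′ : endpointʳ (s ∷ rs) ≡ w
    e′ = trans (cong (_⊕ vec s) e) u+s≡w

EndsWith↔Walk : ∀ {s u w} → ¬ Vertical s → NonNeg w → u ⊕ vec s ≡ w → EndsWith s w ↔ Walk u
EndsWith↔Walk {s} ¬vs w≥0 u+s≡w =
  Σ-⇔ (λ rs → IsWalk-irrelevant (s ∷ rs)) IsWalk-irrelevant λ rs →
    mk⇔ proj₂ (adjacent rs ,_) ⇔-∘ IsWalk-∷ rs w≥0 u+s≡w
  where
  adjacent : ∀ rs → Adjacent s rs
  adjacent []      = tt
  adjacent (_ ∷ _) = ¬vs ∘ proj₁

EndsWith↔HWalk : ∀ {s u w} → Vertical s → NonNeg w → u ⊕ vec s ≡ w → EndsWith s w ↔ HWalk u
EndsWith↔HWalk {s} vs w≥0 u+s≡w =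
  Σ-⇔ (λ rs → IsWalk-irrelevant (s ∷ rs))
      (λ rs (h , c) (h′ , c′) →
         cong₂ _,_ (EndsHorizontally-irrelevant rs h h′) (IsWalk-irrelevant rs c c′)) λ rs →
    (adjacent rs ×-⇔ ⇔-id _) ⇔-∘ IsWalk-∷ rs w≥0 u+s≡w
  where
  adjacent : ∀ rs → Adjacent s rs ⇔ EndsHorizontally rs
  adjacent []      = ⇔-id _
  adjacent (_ ∷ _) = mk⇔ (λ ¬st vt → ¬st (vs , vt)) (λ ¬vt st → ¬vt (proj₂ st))

endpointʳ-x-nonneg : ∀ rs → + 0 ≤ proj₁ (endpointʳ rs)
endpointʳ-x-nonneg []       = +≤+ z≤n
endpointʳ-x-nonneg (s ∷ rs) = ℤ.+-mono-≤ (endpointʳ-x-nonneg rs) (step-x-nonneg s)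
  where
  step-x-nonneg : ∀ s → + 0 ≤ proj₁ (vec s)
  step-x-nonneg up    = +≤+ z≤n
  step-x-nonneg down  = +≤+ z≤n
  step-x-nonneg flat  = +≤+ z≤n
  step-x-nonneg vup   = +≤+ z≤n
  step-x-nonneg vdown = +≤+ z≤n

endpointʳ-nonneg : ∀ rs → All NonNeg (verticesʳ rs) → NonNeg (endpointʳ rs)
endpointʳ-nonneg []      (p ∷ _) = p
endpointʳ-nonneg (_ ∷ _) (p ∷ _) = p

+0≰-[1+_] : ∀ k → ¬ (+ 0 ≤ -[1+ k ])
+0≰-[1+ k ] ()

Walk-x-neg : ∀ {k y} → ¬ Walk (-[1+ k ] , y)
Walk-x-neg {k} (rs , _ , _ , e) =
  +0≰-[1+ k ] (subst (λ v → + 0 ≤ proj₁ v) e (endpointʳ-x-nonneg rs))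

Walk-y-neg : ∀ {x k} → ¬ Walk (x , -[1+ k ])
Walk-y-neg {k = k} (rs , _ , a , e) = +0≰-[1+ k ] (subst NonNeg e (endpointʳ-nonneg rs a))

atOrigin : ℕ → ℕ → ℕ
atOrigin zero    zero    = 1
atOrigin zero    (suc _) = 0
atOrigin (suc _) _       = 0

atOrigin↔ : ∀ x y → Fin (atOrigin x y) ↔ IsWalk (+ x , + y) []
atOrigin↔ zero    zero    = Fin1↔ (IsWalk-irrelevant []) (tt , +≤+ z≤n ∷ [] , refl)
atOrigin↔ zero    (suc y) = ¬⇒Fin0↔ λ { (_ , _ , ()) }
atOrigin↔ (suc x) y       = ¬⇒Fin0↔ λ { (_ , _ , ()) }

-- #walk x y and #hwalk x y are C(x,y) and H(x,y) of the header; #walk₋ᵢ x is #walk (x - i),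
-- which vanishes when x < i.
mutual
  #walk : ℕ → ℤ → ℕ
  #walk x -[1+ _ ] = 0
  #walk x (+ y)    = #hwalk x (+ y) +ℕ (#hwalk x (+ y - + 2) +ℕ #hwalk x (+ y + + 2))

  #hwalk : ℕ → ℤ → ℕ
  #hwalk x -[1+ _ ] = 0
  #hwalk x (+ y)    =
    atOrigin x y +ℕ (#walk₋₁ x (+ y - + 1) +ℕ (#walk₋₁ x (+ y + + 1) +ℕ #walk₋₂ x (+ y)))

  #walk₋₁ : ℕ → ℤ → ℕ
  #walk₋₁ zero    _ = 0
  #walk₋₁ (suc x) y = #walk x y

  #walk₋₂ : ℕ → ℤ → ℕ
  #walk₋₂ zero    _ = 0
  #walk₋₂ (suc x) y = #walk₋₁ x y

mutual
  #walk↔ : ∀ x y → Fin (#walk x y) ↔ Walk (+ x , y)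
  #walk↔ x -[1+ k ] = ¬⇒Fin0↔ Walk-y-neg
  #walk↔ x (+ y)    = ↔-trans
    (Fin-+↔ (#hwalk↔ x (+ y))
      (Fin-+↔ (↔-trans (#hwalk↔ x (+ y - + 2)) (vertical-into tt below))
              (↔-trans (#hwalk↔ x (+ y + + 2)) (vertical-into tt above))))
    (↔-sym (Walk↔lastStep (+ x , + y)))
    where
    vertical-into : ∀ {s u} → Vertical s → u ⊕ vec s ≡ (+ x , + y) →
                    HWalk u ↔ EndsWith s (+ x , + y)
    vertical-into vs eq = ↔-sym (EndsWith↔HWalk vs (+≤+ z≤n) eq)
    below : (+ x , + y - + 2) ⊕ vec vup ≡ (+ x , + y)
    below = cong₂ _,_ (ℤ.+-identityʳ (+ x)) (i-j+j≡i (+ y) (+ 2))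
    above : (+ x , + y + + 2) ⊕ vec vdown ≡ (+ x , + y)
    above = cong₂ _,_ (ℤ.+-identityʳ (+ x)) (i+j-j≡i (+ y) (+ 2))

  #hwalk↔ : ∀ x y → Fin (#hwalk x y) ↔ HWalk (+ x , y)
  #hwalk↔ x -[1+ k ] = ¬⇒Fin0↔ (Walk-y-neg ∘ λ (rs , _ , c) → rs , c)
  #hwalk↔ x (+ y)    = ↔-trans
    (Fin-+↔ (atOrigin↔ x y)
      (Fin-+↔ (↔-trans (#walk₋₁↔ x (+ y - + 1)) (horizontal-into (λ ()) after-up))
        (Fin-+↔ (↔-trans (#walk₋₁↔ x (+ y + + 1)) (horizontal-into (λ ()) after-down))
                (↔-trans (#walk₋₂↔ x (+ y)) (horizontal-into (λ ()) after-flat)))))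
    (↔-sym (HWalk↔lastStep (+ x , + y)))
    where
    horizontal-into : ∀ {s u} → ¬ Vertical s → u ⊕ vec s ≡ (+ x , + y) →
                      Walk u ↔ EndsWith s (+ x , + y)
    horizontal-into ¬vs eq = ↔-sym (EndsWith↔Walk ¬vs (+≤+ z≤n) eq)
    after-up : (+ x - + 1 , + y - + 1) ⊕ vec up ≡ (+ x , + y)
    after-up = cong₂ _,_ (i-j+j≡i (+ x) (+ 1)) (i-j+j≡i (+ y) (+ 1))
    after-down : (+ x - + 1 , + y + + 1) ⊕ vec down ≡ (+ x , + y)
    after-down = cong₂ _,_ (i-j+j≡i (+ x) (+ 1)) (i+j-j≡i (+ y) (+ 1))
    after-flat : (+ x - + 2 , + y) ⊕ vec flat ≡ (+ x , + y)
    after-flat = cong₂ _,_ (i-j+j≡i (+ x) (+ 2)) (ℤ.+-identityʳ (+ y))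

  #walk₋₁↔ : ∀ x y → Fin (#walk₋₁ x y) ↔ Walk (+ x - + 1 , y)
  #walk₋₁↔ zero    y = ¬⇒Fin0↔ Walk-x-neg
  #walk₋₁↔ (suc x) y = #walk↔ x y

  #walk₋₂↔ : ∀ x y → Fin (#walk₋₂ x y) ↔ Walk (+ x - + 2 , y)
  #walk₋₂↔ zero          y = ¬⇒Fin0↔ Walk-x-neg
  #walk₋₂↔ (suc zero)    y = ¬⇒Fin0↔ Walk-x-neg
  #walk₋₂↔ (suc (suc x)) y = #walk↔ x y

-- Each left-hand side below is #walk (suc x) (+ m) as it unfolds: the three #hwalk terms at
-- heights m, m - 2 and m + 2, each a sum of #walk x at the two neighbouring heights and
-- #walk₋₁ x at the same height.
#walk-rec₀ : ∀ x → #walk (suc x) (+ 0) ≡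
  #walk x (+ 3) +ℕ #walk₋₁ x (+ 2) +ℕ 2 *ℕ #walk x (+ 1) +ℕ #walk₋₁ x (+ 0)
#walk-rec₀ x = rearrange (#walk x (+ 1)) (#walk₋₁ x (+ 0)) (#walk x (+ 3)) (#walk₋₁ x (+ 2))
  where
  rearrange : ∀ f₁ g₀ f₃ g₂ →
    (f₁ +ℕ g₀) +ℕ (f₁ +ℕ (f₃ +ℕ g₂)) ≡ f₃ +ℕ g₂ +ℕ 2 *ℕ f₁ +ℕ g₀
  rearrange = solve-∀

#walk-rec₁ : ∀ x → #walk (suc x) (+ 1) ≡
  #walk x (+ 4) +ℕ #walk₋₁ x (+ 3) +ℕ 2 *ℕ #walk x (+ 2) +ℕ #walk₋₁ x (+ 1) +ℕ #walk x (+ 0)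
#walk-rec₁ x = rearrange (#walk x (+ 0)) (#walk x (+ 2)) (#walk₋₁ x (+ 1))
                         (#walk x (+ 4)) (#walk₋₁ x (+ 3))
  where
  rearrange : ∀ f₀ f₂ g₁ f₄ g₃ →
    (f₀ +ℕ (f₂ +ℕ g₁)) +ℕ (f₂ +ℕ (f₄ +ℕ g₃)) ≡ f₄ +ℕ g₃ +ℕ 2 *ℕ f₂ +ℕ g₁ +ℕ f₀
  rearrange = solve-∀

#walk-rec₂ : ∀ x → #walk (suc x) (+ 2) ≡
  #walk x (+ 5) +ℕ #walk₋₁ x (+ 4) +ℕ 2 *ℕ #walk x (+ 3) +ℕ #walk₋₁ x (+ 2)
  +ℕ 2 *ℕ #walk x (+ 1) +ℕ #walk₋₁ x (+ 0)
#walk-rec₂ x = rearrange (#walk x (+ 1)) (#walk x (+ 3)) (#walk₋₁ x (+ 2)) (#walk₋₁ x (+ 0))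
                         (#walk x (+ 5)) (#walk₋₁ x (+ 4))
  where
  rearrange : ∀ f₁ f₃ g₂ g₀ f₅ g₄ →
    (f₁ +ℕ (f₃ +ℕ g₂)) +ℕ ((f₁ +ℕ g₀) +ℕ (f₃ +ℕ (f₅ +ℕ g₄)))
      ≡ f₅ +ℕ g₄ +ℕ 2 *ℕ f₃ +ℕ g₂ +ℕ 2 *ℕ f₁ +ℕ g₀
  rearrange = solve-∀

#walk-rec₃ : ∀ x k → let m = 3 +ℕ k in #walk (suc x) (+ m) ≡
  #walk x (+ (m +ℕ 3)) +ℕ #walk₋₁ x (+ (m +ℕ 2)) +ℕ 2 *ℕ #walk x (+ (m +ℕ 1))
  +ℕ #walk₋₁ x (+ m) +ℕ 2 *ℕ #walk x (+ (m ∸ 1)) +ℕ #walk₋₁ x (+ (m ∸ 2)) +ℕ #walk x (+ (m ∸ 3))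
-- Heights such as (m + 2) + 1 arising from the unfolding equal the statement's m + 3 only
-- propositionally, hence the three equations handed to rearrange′.
#walk-rec₃ x k =
  rearrange′ (#walk₋₁ x (+ m)) (#walk x (+ k)) (#walk₋₁ x (+ suc k)) (#walk₋₁ x (+ (m +ℕ 2)))
    (cong (#walk x ∘ +_) (cong suc (ℕ.+-comm k 1)))
    (cong (#walk x ∘ +_) (cong (suc ∘ suc) (ℕ.+-suc k 1)))
    (cong (#walk x ∘ +_) (ℕ.+-assoc m 2 1))
  where
  m = 3 +ℕ k
  rearrange : ∀ f₋₁ f₊₁ g₀ f₋₃ g₋₂ f₊₃ g₊₂ →
    (f₋₁ +ℕ (f₊₁ +ℕ g₀)) +ℕ ((f₋₃ +ℕ (f₋₁ +ℕ g₋₂)) +ℕ (f₊₁ +ℕ (f₊₃ +ℕ g₊₂)))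
      ≡ f₊₃ +ℕ g₊₂ +ℕ 2 *ℕ f₊₁ +ℕ g₀ +ℕ 2 *ℕ f₋₁ +ℕ g₋₂ +ℕ f₋₃
  rearrange = solve-∀
  rearrange′ : ∀ {f₋₁ f₊₁ f₊₃ f₋₁′ f₊₁′ f₊₃′} g₀ f₋₃ g₋₂ g₊₂ →
    f₋₁′ ≡ f₋₁ → f₊₁′ ≡ f₊₁ → f₊₃′ ≡ f₊₃ →
    (f₋₁ +ℕ (f₊₁ +ℕ g₀)) +ℕ ((f₋₃ +ℕ (f₋₁′ +ℕ g₋₂)) +ℕ (f₊₁′ +ℕ (f₊₃′ +ℕ g₊₂)))
      ≡ f₊₃ +ℕ g₊₂ +ℕ 2 *ℕ f₊₁ +ℕ g₀ +ℕ 2 *ℕ f₋₁ +ℕ g₋₂ +ℕ f₋₃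
  rearrange′ {f₋₁} {f₊₁} {f₊₃} g₀ f₋₃ g₋₂ g₊₂ refl refl refl =
    rearrange f₋₁ f₊₁ g₀ f₋₃ g₋₂ f₊₃ g₊₂

C : ℤ → ℕ → ℕ
C (+ x)    m = #walk x (+ m)
C -[1+ _ ] _ = 0

C↔QPath : ∀ n m → Fin (C n m) ↔ QPath n (+ m)
C↔QPath (+ x)    m = ↔-trans (#walk↔ x (+ m)) (Walk↔QPath (+ x) (+ m))
C↔QPath -[1+ k ] m = ↔-trans (¬⇒Fin0↔ Walk-x-neg) (Walk↔QPath -[1+ k ] (+ m))

C-neg : ∀ p m → p < + 0 → C p m ≡ 0
C-neg -[1+ _ ] _ _         = refl
C-neg (+ _)    _ (+<+ ())

C-start : ∀ m → (m ≡ 0 ⊎ m ≡ 2) → C (+ 0) m ≡ 1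
C-start _ (inj₁ refl) = refl
C-start _ (inj₂ refl) = refl

C-start-elsewhere : ∀ m → m ≢ 0 → m ≢ 2 → C (+ 0) m ≡ 0
C-start-elsewhere 0                   m≢0 _   = ⊥-elim (m≢0 refl)
C-start-elsewhere 1                   _   _   = refl
C-start-elsewhere 2                   _   m≢2 = ⊥-elim (m≢2 refl)
C-start-elsewhere (suc (suc (suc _))) _   _   = refl

-- n - + 2 only computes once n is a numeral or has the form + suc (suc x), hence the split
-- between n = 1 and n ≥ 2; in both cases the #walk recurrence applies definitionally.
C-rec₀ : ∀ n → + 1 ≤ n →
  C n 0 ≡ C (n - + 1) 3 +ℕ C (n - + 2) 2 +ℕ 2 *ℕ C (n - + 1) 1 +ℕ C (n - + 2) 0
C-rec₀ (+ 1)             _ = #walk-rec₀ 0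
C-rec₀ (+ suc (suc x))   _ = #walk-rec₀ (suc x)
C-rec₀ (+ 0)             (+≤+ ())

C-rec₁ : ∀ n → + 1 ≤ n →
  C n 1 ≡ C (n - + 1) 4 +ℕ C (n - + 2) 3 +ℕ 2 *ℕ C (n - + 1) 2 +ℕ C (n - + 2) 1
          +ℕ C (n - + 1) 0
C-rec₁ (+ 1)             _ = #walk-rec₁ 0
C-rec₁ (+ suc (suc x))   _ = #walk-rec₁ (suc x)
C-rec₁ (+ 0)             (+≤+ ())

C-rec₂ : ∀ n → + 1 ≤ n →
  C n 2 ≡ C (n - + 1) 5 +ℕ C (n - + 2) 4 +ℕ 2 *ℕ C (n - + 1) 3 +ℕ C (n - + 2) 2
          +ℕ 2 *ℕ C (n - + 1) 1 +ℕ C (n - + 2) 0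
C-rec₂ (+ 1)             _ = #walk-rec₂ 0
C-rec₂ (+ suc (suc x))   _ = #walk-rec₂ (suc x)
C-rec₂ (+ 0)             (+≤+ ())

C-rec₃ : ∀ n m → + 1 ≤ n → 3 ≤ℕ m →
  C n m ≡ C (n - + 1) (m +ℕ 3) +ℕ C (n - + 2) (m +ℕ 2) +ℕ 2 *ℕ C (n - + 1) (m +ℕ 1)
          +ℕ C (n - + 2) m +ℕ 2 *ℕ C (n - + 1) (m ∸ 1) +ℕ C (n - + 2) (m ∸ 2)
          +ℕ C (n - + 1) (m ∸ 3)
C-rec₃ (+ 1)           (suc (suc (suc k))) _        _ = #walk-rec₃ 0 k
C-rec₃ (+ suc (suc x)) (suc (suc (suc k))) _        _ = #walk-rec₃ (suc x) k
C-rec₃ (+ 0)           _                   (+≤+ ()) _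
C-rec₃ (+ suc _)       (suc (suc zero))    _        (s≤s (s≤s ()))
C-rec₃ (+ suc _)       (suc zero)          _        (s≤s ())
C-rec₃ (+ suc _)       zero                _        ()

lemma20 : Σ (ℤ → ℕ → ℕ) λ C →
    (∀ n m → Fin (C n m) ↔ QPath n (+ m))
  × (∀ p m → p < + 0 → C p m ≡ 0)
  × (∀ m → (m ≡ 0 ⊎ m ≡ 2) → C (+ 0) m ≡ 1)
  × (∀ m → m ≢ 0 → m ≢ 2 → C (+ 0) m ≡ 0)
  × (∀ n → + 1 ≤ n →
       C n 0 ≡ C (n - + 1) 3 +ℕ C (n - + 2) 2 +ℕ 2 *ℕ C (n - + 1) 1 +ℕ C (n - + 2) 0)
  × (∀ n → + 1 ≤ n →
       C n 1 ≡ C (n - + 1) 4 +ℕ C (n - + 2) 3 +ℕ 2 *ℕ C (n - + 1) 2 +ℕ C (n - + 2) 1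
               +ℕ C (n - + 1) 0)
  × (∀ n → + 1 ≤ n →
       C n 2 ≡ C (n - + 1) 5 +ℕ C (n - + 2) 4 +ℕ 2 *ℕ C (n - + 1) 3 +ℕ C (n - + 2) 2
               +ℕ 2 *ℕ C (n - + 1) 1 +ℕ C (n - + 2) 0)
  × (∀ n m → + 1 ≤ n → 3 ≤ℕ m →
       C n m ≡ C (n - + 1) (m +ℕ 3) +ℕ C (n - + 2) (m +ℕ 2) +ℕ 2 *ℕ C (n - + 1) (m +ℕ 1)
               +ℕ C (n - + 2) m +ℕ 2 *ℕ C (n - + 1) (m ∸ 1) +ℕ C (n - + 2) (m ∸ 2)
               +ℕ C (n - + 1) (m ∸ 3))
lemma20 =
  C , C↔QPath , C-neg , C-start , C-start-elsewhere , C-rec₀ , C-rec₁ , C-rec₂ , C-rec₃
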